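{- Let $G$ be a graph, $r \in V(G)$, and $S \subseteq V(G)$ with $r \notin S$. If the bilevel integer linear program $PI_S(G,r)$ is infeasible, then $\pi_S(G,r) \le |V(G)|$. Otherwise, the optimal objective value of $PI_S(G,r)$ is exactly $\pi_S(G,r) - 1$.
   Context: All graphs are simple and connected. A pebbling configuration on $G$ is a map $p: V(G)\to\mathbb{Z}_{\ge 0}$ with size $|p|=\sum_v p(v)$ and support $\{v: p(v)>0\}$. A pebbling move removes two pebbles from one vertex and places one on an adjacent vertex; $p$ is $r$-solvable if some sequence of moves yields a configuration with at least one pebble on $r$. $\pi_S(G,r)$ is the least $m$ such that every configuration of size $m$ with support contained in $S$ is $r$-solvable. The arc set is $A(G)=\{(u,v): \{u,v\}\in E(G)\}$; $\delta^-(v)$ is the set of arcs $(u,v)$ into $v$ and $\delta^+(v)$ the set of arcs $(v,u)$ out of $v$. For a configuration $p$, $SOL_p(G,r)$ is the integer program in variables $z_a\in\mathbb{Z}_{\ge0}$ ($a\in A(G)$): maximize $\sum_{a\in\delta^-(r)} z_a$ subject to $\sum_{a\in\delta^+(v)} 2z_a \le p(v)+\sum_{a\in\delta^-(v)} z_a$ for all $v$, and $\sum_{a\in\delta^+(r)} z_a\le 0$. The bilevel program $PI_S(G,r)$ (in the optimistic sense: the leader chooses upper-level variables, and among the follower's optimal responses the one best for the leader is taken) has upper-level variables $y_v\in\mathbb{Z}_{\ge0}$ for $v\in S$ and lower-level variables $x\in\mathbb{Z}_{\ge 0}^{A(G)}$: maximize $\sum_{v\in S} y_v$ subject to $\sum_{v\in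 S} y_v \ge |V(G)|$, $x$ is an optimal solution of $SOL_{p_y}(G,r)$ where $p_y(v)=y_v$ for $v\in S$ and $p_y(v)=0$ otherwise, and $\sum_{a\in\delta^-(r)} x_a \le 0$. A feasible solution is a pair $(x,y)$ satisfying all these constraints; the program is infeasible if none exists, and its optimal objective value is the maximum of $\sum_{v\in S} y_v$ over feasible solutions. -}

module Defs where

open import Data.Nat using (ℕ; zero; suc; _+_; _*_; _∸_; _≤_; _<_)
open import Data.Bool using (Bool; true; false; if_then_else_)
open import Data.Fin using (Fin; zero; suc; _≟_)
open import Data.Fin.Subset using (Subset; _∈_; _∉_)
open import Data.Product using (Σ; ∃; ∃-syntax; _×_; _,_)
open import Relation.Nullary using (¬_; does)
open import Relation.Binary.PropositionalEquality using (_≡_)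
open import Relation.Binary.Construct.Closure.ReflexiveTransitive using (Star)

sumFin : ∀ {n} → (Fin n → ℕ) → ℕ
sumFin {zero}  f = 0
sumFin {suc n} f = f zero + sumFin (λ i → f (suc i))

record Graph (n : ℕ) : Set where
  field
    adj       : Fin n → Fin n → Bool
    adj-sym   : ∀ u v → adj u v ≡ adj v u
    adj-irr   : ∀ v → adj v v ≡ false
    connected : ∀ u v → Star (λ a b → adj a b ≡ true) u v
open Graph public

Config : ℕ → Set
Config n = Fin n → ℕ

size : ∀ {n} → Config n → ℕ
size p = sumFin p

SupportIn : ∀ {n} → Config n → Subset n → Set
SupportIn p S = ∀ v → 0 < p v → v ∈ S

moveConfig : ∀ {n} → Config n → Fin n → Fin n → Config n
moveConfig p u v w =
  if does (w ≟ u) then p w ∸ 2 else (if does (w ≟ v) then p w + 1 else p w)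

Move : ∀ {n} → Graph n → Config n → Config n → Set
Move G p q = ∃[ u ] ∃[ v ] (adj G u v ≡ true × 2 ≤ p u × q ≡ moveConfig p u v)

Solvable : ∀ {n} → Graph n → Fin n → Config n → Set
Solvable G r p = ∃[ q ] (Star (Move G) p q × 1 ≤ q r)

AllSolvable : ∀ {n} → Graph n → Subset n → Fin n → ℕ → Set
AllSolvable G S r m = ∀ p → size p ≡ m → SupportIn p S → Solvable G r p

IsPebblingNumber : ∀ {n} → Graph n → Subset n → Fin n → ℕ → Set
IsPebblingNumber G S r m = AllSolvable G S r m × (∀ k → AllSolvable G S r k → m ≤ k)

-- arc variables: z u v is the variable of arc (u , v); vanishing off A(G)
ArcVars : ℕ → Set
ArcVars n = Fin n → Fin n → ℕ

OnArcs : ∀ {n} → Graph n → ArcVars n → Set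
OnArcs G z = ∀ u v → adj G u v ≡ false → z u v ≡ 0

inflow : ∀ {n} → Graph n → ArcVars n → Fin n → ℕ
inflow G z v = sumFin (λ u → if adj G u v then z u v else 0)

outflow : ∀ {n} → Graph n → ArcVars n → Fin n → ℕ
outflow G z v = sumFin (λ u → if adj G v u then z v u else 0)

SOLFeasible : ∀ {n} → Graph n → Fin n → Config n → ArcVars n → Set
SOLFeasible G r p z =
  OnArcs G z
  × (∀ v → 2 * outflow G z v ≤ p v + inflow G z v)
  × outflow G z r ≤ 0

SOLObj : ∀ {n} → Graph n → Fin n → ArcVars n → ℕ
SOLObj G r z = inflow G z r

SOLOptimal : ∀ {n} → Graph n → Fin n → Config n → ArcVars n → Set
SOLOptimal G r p x =
  SOLFeasible G r p x × (∀ z → SOLFeasible G r p z → SOLObj G r z ≤ SOLObj G r x)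

-- upper-level variables y_v (v ∈ S), represented as p_y (zero outside S)
UpperVars : ∀ {n} → Subset n → Config n → Set
UpperVars S y = ∀ v → v ∉ S → y v ≡ 0

-- feasible solutions (x , y) of PI_S(G, r); objective Σ_{v∈S} y_v = size y
PIFeasible : ∀ {n} → Graph n → Subset n → Fin n → ArcVars n → Config n → Set
PIFeasible {n} G S r x y =
  UpperVars S y
  × n ≤ size y
  × SOLOptimal G r y x
  × SOLObj G r x ≤ 0

PIIsFeasible : ∀ {n} → Graph n → Subset n → Fin n → Set
PIIsFeasible G S r = ∃[ x ] ∃[ y ] PIFeasible G S r x y

PIOptimalValue : ∀ {n} → Graph n → Subset n → Fin n → ℕ → Set
PIOptimalValue G S r k =
  (∃[ x ] ∃[ y ] (PIFeasible G S r x y × size y ≡ k))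
  × (∀ x y → PIFeasible G S r x y → size y ≤ k)

{-# OPTIONS --safe #-}

-- A configuration p is r-solvable iff SOL_p(G, r) has a feasible z with p r plus the
-- inflow of z into r at least 1.  The moves of a solving sequence, counted along each
-- arc, give such a z; conversely such a z can be unwound one pebbling move at a time,
-- since some vertex holding two pebbles has positive outflow.  So (x , y) is feasible
-- for PI_S(G, r) exactly when y is an r-unsolvable configuration supported on S of size
-- at least |V(G)|, and x is then optimal with value 0.  Solvability is decidable (every
-- move loses a pebble) and monotone in the configuration, and a configuration of size
-- Σ_u 2 ^ (length of a path from u to r) is solvable; hence π_S(G, r) exists, and the
-- largest size of an unsolvable configuration supported on S is π_S(G, r) − 1.

module Submission where

open import Defs
open import Data.Nat using (ℕ; zero; suc; pred; >-nonZero; _+_; _*_; _∸_; _^_; _≤_; _<_; z≤n; s≤s; s≤s⁻¹; z<s)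
open import Data.Nat.Properties hiding (_≟_)
import Data.Nat.Properties as ℕ
open import Data.Bool using (true; false; if_then_else_)
import Data.Bool.Properties as Bool
open import Data.Fin using (Fin; zero; suc; _≟_; punchIn; toℕ; fromℕ<; finToFun; funToFin)
open import Data.Fin.Properties using (any?; all?; punchInᵢ≢i; toℕ-fromℕ<; finToFun-funToFin)
open import Data.Fin.Subset using (Subset; _∉_)
open import Data.Fin.Subset.Properties using (_∈?_)
open import Data.Product using (∃-syntax; _×_; _,_; proj₁; proj₂; map)
open import Data.Sum using (_⊎_; inj₁; inj₂)
open import Data.Vec.Functional using (updateAt)
open import Data.Vec.Functional.Properties using (updateAt-updates; updateAt-minimal)
open import Function using (_∘_; id; _⇔_; mk⇔; Equivalence)
open import Relation.Nullary using (¬_; Dec; yes; no; contradiction)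
open import Relation.Nullary.Decidable using (_×-dec_; _→-dec_; ¬?; map′; dec-true; dec-false; decidable-stable)
open import Relation.Binary.PropositionalEquality
open import Relation.Binary.Construct.Closure.ReflexiveTransitive using (Star; ε; _◅_; _◅◅_)
open import Algebra.Properties.CommutativeMonoid.Sum +-0-commutativeMonoid
  using (sum; sum-cong-≗; sum-remove; sum-replicate-zero; ∑-comm)
open import Algebra.Properties.CommutativeSemigroup +-commutativeSemigroup using (xy∙z≈xz∙y)

sumFin≡sum : ∀ {n} (f : Fin n → ℕ) → sumFin f ≡ sum f
sumFin≡sum {zero}  f = refl
sumFin≡sum {suc _} f = cong (f zero +_) (sumFin≡sum (f ∘ suc))

sumFin-cong : ∀ {n} {f g : Fin n → ℕ} → f ≗ g → sumFin f ≡ sumFin g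
sumFin-cong {f = f} {g} f≗g = trans (sumFin≡sum f) (trans (sum-cong-≗ f≗g) (sym (sumFin≡sum g)))

sumFin-zero : ∀ n → sumFin {n} (λ _ → 0) ≡ 0
sumFin-zero n = trans (sumFin≡sum {n} _) (sum-replicate-zero n)

sumFin-comm : ∀ {m n} (f : Fin m → Fin n → ℕ) →
  sumFin (λ i → sumFin (f i)) ≡ sumFin (λ j → sumFin (λ i → f i j))
sumFin-comm f = begin
  sumFin (λ i → sumFin (f i))          ≡⟨ sumFin-cong (λ i → sumFin≡sum (f i)) ⟩
  sumFin (λ i → sum (f i))             ≡⟨ sumFin≡sum (λ i → sum (f i)) ⟩
  sum (λ i → sum (f i))                ≡⟨ ∑-comm f ⟩
  sum (λ j → sum (λ i → f i j))        ≡⟨ sumFin≡sum (λ j → sum (λ i → f i j)) ⟨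
  sumFin (λ j → sum (λ i → f i j))     ≡⟨ sumFin-cong (λ j → sumFin≡sum (λ i → f i j)) ⟨
  sumFin (λ j → sumFin (λ i → f i j))  ∎
  where open ≡-Reasoning

sumFin-differ : ∀ {n} {f g : Fin n → ℕ} i {k} →
  (∀ j → j ≢ i → f j ≡ g j) → f i + k ≡ g i → sumFin f + k ≡ sumFin g
sumFin-differ {suc _} {f} {g} i {k} off at = begin
  sumFin f + k                  ≡⟨ cong (_+ k) (trans (sumFin≡sum f) (sum-remove {i = i} f)) ⟩
  f i + sum (f ∘ punchIn i) + k  ≡⟨ xy∙z≈xz∙y (f i) _ k ⟩
  f i + k + sum (f ∘ punchIn i)  ≡⟨ cong₂ _+_ at (sum-cong-≗ (λ j → off (punchIn i j) (punchInᵢ≢i i j))) ⟩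
  g i + sum (g ∘ punchIn i)      ≡⟨ trans (sumFin≡sum g) (sum-remove {i = i} g) ⟨
  sumFin g                       ∎
  where open ≡-Reasoning

sumFin-mono-≤ : ∀ {n} {f g : Fin n → ℕ} → (∀ i → f i ≤ g i) → sumFin f ≤ sumFin g
sumFin-mono-≤ {zero}  f≤g = z≤n
sumFin-mono-≤ {suc _} f≤g = +-mono-≤ (f≤g zero) (sumFin-mono-≤ (f≤g ∘ suc))

sumFin-mono-< : ∀ {n} {f g : Fin n → ℕ} → (∀ i → f i ≤ g i) → ∀ j → f j < g j → sumFin f < sumFin g
sumFin-mono-< f≤g zero    fj<gj = +-mono-<-≤ fj<gj (sumFin-mono-≤ (f≤g ∘ suc))
sumFin-mono-< f≤g (suc j) fj<gj = +-mono-≤-< (f≤g zero) (sumFin-mono-< (f≤g ∘ suc) j fj<gj)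

≤-sumFin : ∀ {n} (f : Fin n → ℕ) i → f i ≤ sumFin f
≤-sumFin f zero    = m≤m+n _ _
≤-sumFin f (suc i) = ≤-trans (≤-sumFin (f ∘ suc) i) (m≤n+m _ _)

sumFin-pos : ∀ {n} (f : Fin n → ℕ) → 0 < sumFin f → ∃[ i ] 0 < f i
sumFin-pos {suc _} f pos with f zero in f₀
... | suc _ = zero , subst (0 <_) (sym f₀) z<s
... | zero  = map suc id (sumFin-pos (f ∘ suc) pos)

least-upward-closed : ∀ {ℓ} (P : ℕ → Set ℓ) → (∀ {m k} → P m → m ≤ k → P k) → (∀ k → Dec (P k)) →
  ∀ {b} → P b → ∃[ m ] (P m × (∀ k → P k → m ≤ k))
least-upward-closed P up P? {zero}  P0   = 0 , P0 , λ _ _ → z≤n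
least-upward-closed P up P? {suc b} Pb+1 with P? b
... | yes Pb  = least-upward-closed P up P? Pb
... | no  ¬Pb = suc b , Pb+1 , λ k Pk → ≰⇒> (λ k≤b → ¬Pb (up Pk k≤b))

2*o≤P+I⇒o≤I : ∀ {o P I} → 2 * o ≤ P + I → (0 < o → P < 2) → o ≤ I
2*o≤P+I⇒o≤I {zero}          _         _    = z≤n
2*o≤P+I⇒o≤I {suc o} {P} {I} 2o≤P+I P<2 = begin
  suc o          ≤⟨ m≤n+m (suc o) o ⟩
  o + suc o      ≤⟨ s≤s⁻¹ (begin
    suc o + suc o  ≡⟨ cong (suc o +_) (+-identityʳ (suc o)) ⟨
    2 * suc o      ≤⟨ 2o≤P+I ⟩
    P + I          ≤⟨ +-monoˡ-≤ I (s≤s⁻¹ (P<2 z<s)) ⟩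
    suc I          ∎) ⟩
  I              ∎
  where open ≤-Reasoning

2*o≤P∸2+I⇔2*[o+1]≤P+I : ∀ {o P I} → 2 ≤ P → (2 * o ≤ P ∸ 2 + I) ⇔ (2 * (o + 1) ≤ P + I)
2*o≤P∸2+I⇔2*[o+1]≤P+I {o} {P} {I} (s≤s (s≤s _)) =
  mk⇔ (subst (_≤ P + I) (sym 2[o+1]≡2+2o) ∘ +-monoʳ-≤ 2)
      (+-cancelˡ-≤ 2 _ _ ∘ subst (_≤ P + I) 2[o+1]≡2+2o)
  where
  2[o+1]≡2+2o : 2 * (o + 1) ≡ 2 + 2 * o
  2[o+1]≡2+2o = trans (cong (2 *_) (+-comm o 1)) (*-suc 2 o)

moveConfig-source : ∀ {n} (p : Config n) u v → moveConfig p u v u ≡ p u ∸ 2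
moveConfig-source p u v rewrite dec-true (u ≟ u) refl = refl

moveConfig-target : ∀ {n} (p : Config n) {u v} → v ≢ u → moveConfig p u v v ≡ p v + 1
moveConfig-target p {u} {v} v≢u rewrite dec-false (v ≟ u) v≢u | dec-true (v ≟ v) refl = refl

moveConfig-other : ∀ {n} (p : Config n) {u v w} → w ≢ u → w ≢ v → moveConfig p u v w ≡ p w
moveConfig-other p {u} {v} {w} w≢u w≢v rewrite dec-false (w ≟ u) w≢u | dec-false (w ≟ v) w≢v = refl

size-moveConfig : ∀ {n} (p : Config n) {u v} → v ≢ u → 2 ≤ p u → suc (size (moveConfig p u v)) ≡ size p
size-moveConfig p {u} {v} v≢u 2≤pu = begin
  suc (size (moveConfig p u v))  ≡⟨ +-comm 1 _ ⟩
  size (moveConfig p u v) + 1  ≡⟨ cong (_+ 1) (sumFin-differ v agree-off-v at-v) ⟨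
  sumFin removed + 1 + 1       ≡⟨ +-assoc (sumFin removed) 1 1 ⟩
  sumFin removed + 2           ≡⟨ sumFin-differ u (λ j j≢u → updateAt-minimal j u p j≢u) at-u ⟩
  size p                       ∎
  where
  open ≡-Reasoning
  removed : Config _
  removed = updateAt p u (_∸ 2)
  at-u : removed u + 2 ≡ p u
  at-u = trans (cong (_+ 2) (updateAt-updates u p)) (m∸n+n≡m 2≤pu)
  at-v : removed v + 1 ≡ moveConfig p u v v
  at-v = trans (cong (_+ 1) (updateAt-minimal v u p v≢u)) (sym (moveConfig-target p v≢u))
  agree-off-v : ∀ j → j ≢ v → removed j ≡ moveConfig p u v j
  agree-off-v j j≢v = agree (j ≟ u)
    where
    agree : Dec (j ≡ u) → removed j ≡ moveConfig p u v j
    agree (yes refl) = trans (updateAt-updates j p) (sym (moveConfig-source p j v))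
    agree (no j≢u)   = trans (updateAt-minimal j u p j≢u) (sym (moveConfig-other p j≢u j≢v))

removePebble : ∀ {n} (p : Config n) → 0 < size p → ∃[ p′ ] (suc (size p′) ≡ size p × (∀ w → p′ w ≤ p w))
removePebble p |p|>0 with sumFin-pos p |p|>0
... | v , pv>0 = updateAt p v (_∸ 1) , trans (+-comm 1 _) one-less , fewer
  where
  one-less : size (updateAt p v (_∸ 1)) + 1 ≡ size p
  one-less = sumFin-differ v (λ w w≢v → updateAt-minimal w v p w≢v)
               (trans (cong (_+ 1) (updateAt-updates v p)) (m∸n+n≡m pv>0))
  fewer : ∀ w → updateAt p v (_∸ 1) w ≤ p w
  fewer w with w ≟ v
  ... | yes refl = ≤-trans (≤-reflexive (updateAt-updates w p)) (m∸n≤m (p w) 1)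
  ... | no  w≢v  = ≤-reflexive (updateAt-minimal w v p w≢v)

subconfiguration : ∀ {n} m d (p : Config n) → size p ≡ m + d → ∃[ p′ ] (size p′ ≡ m × (∀ v → p′ v ≤ p v))
subconfiguration m zero    p |p|≡m+0 = p , trans |p|≡m+0 (+-identityʳ m) , λ _ → ≤-refl
subconfiguration m (suc d) p |p|≡m+1+d with trans |p|≡m+1+d (+-suc m d)
... | |p|≡1+m+d with removePebble p (subst (0 <_) (sym |p|≡1+m+d) z<s)
... | p₁ , 1+|p₁|≡|p| , p₁≤p with subconfiguration m d p₁ (suc-injective (trans 1+|p₁|≡|p| |p|≡1+m+d))
... | p′ , |p′|≡m , p′≤p₁ = p′ , |p′|≡m , λ w → ≤-trans (p′≤p₁ w) (p₁≤p w)

-- Configurations bounded by k, as base-(k + 1) digit strings.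
decode : ∀ {n} k → Fin (suc k ^ n) → Config n
decode k i = toℕ ∘ finToFun i

decode-surjective : ∀ {n k} (p : Config n) → (∀ v → p v ≤ k) → ∃[ i ] decode k i ≗ p
decode-surjective p p≤k = funToFin digits , λ v → trans (cong toℕ (finToFun-funToFin digits v)) (toℕ-fromℕ< (s≤s (p≤k v)))
  where
  digits : Fin _ → Fin (suc _)
  digits v = fromℕ< (s≤s (p≤k v))

module _ {n} (G : Graph n) where

  Adj : Fin n → Fin n → Set
  Adj u v = adj G u v ≡ true

  adj⇒≢ : ∀ {u v} → Adj u v → v ≢ u
  adj⇒≢ {u} uv refl = contradiction (trans (sym uv) (adj-irr G u)) λ ()

  pathLength : ∀ {u v} → Star Adj u v → ℕ
  pathLength ε       = 0
  pathLength (_ ◅ w) = suc (pathLength w)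

  push : ∀ {u v} → Adj u v → ∀ k p → 2 * k ≤ p u → ∃[ q ] (Star (Move G) p q × k + p v ≤ q v)
  push uv zero    p _ = p , ε , ≤-refl
  push {u} {v} uv (suc k) p 2[1+k]≤pu =
    let q , p′→q , k+p′v≤qv = push uv k (moveConfig p u v) 2k≤p′u
    in  q , (u , v , uv , m+n≤o⇒m≤o 2 2+2k≤pu , refl) ◅ p′→q , subst (_≤ q v) shift k+p′v≤qv
    where
    2+2k≤pu : 2 + 2 * k ≤ p u
    2+2k≤pu = subst (_≤ p u) (*-suc 2 k) 2[1+k]≤pu
    2k≤p′u : 2 * k ≤ moveConfig p u v u
    2k≤p′u = subst (2 * k ≤_) (sym (moveConfig-source p u v))
               (m+n≤o⇒m≤o∸n (2 * k) (subst (_≤ p u) (+-comm 2 (2 * k)) 2+2k≤pu))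
    shift : k + moveConfig p u v v ≡ suc k + p v
    shift = trans (cong (k +_) (trans (moveConfig-target p (adj⇒≢ uv)) (+-comm (p v) 1))) (+-suc k (p v))

  module _ (r : Fin n) where

    solvable-◅ : ∀ {p q} → Move G p q → Solvable G r q → Solvable G r p
    solvable-◅ p→q (s , q→s , s-r>0) = s , p→q ◅ q→s , s-r>0

    zero-unsolvable : ¬ Solvable G r (λ _ → 0)
    zero-unsolvable (_ , ε , ())
    zero-unsolvable (_ , (_ , _ , _ , () , _) ◅ _ , _)

    solvable-path : ∀ {u} (w : Star Adj u r) p → 2 ^ pathLength w ≤ p u → Solvable G r p
    solvable-path ε        p p-r>0 = p , ε , p-r>0
    solvable-path (uv ◅ w) p enough with push uv (2 ^ pathLength w) p enough
    ... | q , p→q , k+pv≤qv with solvable-path w q (≤-trans (m≤m+n _ _) k+pv≤qv)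
    ...   | s , q→s , s-r>0 = s , p→q ◅◅ q→s , s-r>0

    FirstMove : Config n → Set
    FirstMove p = ∃[ u ] ∃[ v ] (Adj u v × 2 ≤ p u × Solvable G r (moveConfig p u v))

    solvable?-below : ∀ k p → size p < k → Dec (Solvable G r p)
    solvable?-below (suc k) p |p|<1+k with 1 ≤? p r
    ... | yes p-r>0 = yes (p , ε , p-r>0)
    ... | no  p-r≯0 = map′ fromFirstMove toFirstMove (any? λ u → any? λ v → firstMove? u v)
      where
      firstMove? : ∀ u v → Dec (Adj u v × 2 ≤ p u × Solvable G r (moveConfig p u v))
      firstMove? u v with adj G u v Bool.≟ true | 2 ≤? p u
      ... | no ¬uv | _        = no (¬uv ∘ proj₁)
      ... | yes uv | no 2≰pu  = no (2≰pu ∘ proj₁ ∘ proj₂)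
      ... | yes uv | yes 2≤pu = map′ (λ s → uv , 2≤pu , s) (proj₂ ∘ proj₂)
        (solvable?-below k (moveConfig p u v)
          (<-≤-trans (≤-reflexive (size-moveConfig p (adj⇒≢ uv) 2≤pu)) (s≤s⁻¹ |p|<1+k)))
      fromFirstMove : FirstMove p → Solvable G r p
      fromFirstMove (u , v , uv , 2≤pu , s) = solvable-◅ (u , v , uv , 2≤pu , refl) s
      toFirstMove : Solvable G r p → FirstMove p
      toFirstMove (_ , ε , p-r>0) = contradiction p-r>0 p-r≯0
      toFirstMove (s , (u , v , uv , 2≤pu , refl) ◅ q→s , s-r>0) = u , v , uv , 2≤pu , s , q→s , s-r>0

    solvable? : ∀ p → Dec (Solvable G r p)
    solvable? p = solvable?-below (suc (size p)) p ≤-refl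

    solvabilityBound : ℕ
    solvabilityBound = sumFin (λ u → 2 ^ pathLength (connected G u r))

    allSolvable-bound : ∀ S → AllSolvable G S r solvabilityBound
    allSolvable-bound S p |p|≡bound _ with any? (λ u → 2 ^ pathLength (connected G u r) ≤? p u)
    ... | yes (u , enough) = solvable-path (connected G u r) p enough
    ... | no  none         = contradiction (sumFin-mono-< (<⇒≤ ∘ scarce) r (scarce r)) (<-irrefl |p|≡bound)
      where
      scarce : ∀ u → p u < 2 ^ pathLength (connected G u r)
      scarce u = ≰⇒> (λ enough → none (u , enough))

module _ {n} (G : Graph n) where

  record OneMoreOn (a b : Fin n) (z z′ : ArcVars n) : Set where
    field
      on-arc   : z′ a b ≡ suc (z a b)
      off-tail : ∀ {u v} → u ≢ a → z′ u v ≡ z u v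
      off-head : ∀ {u v} → v ≢ b → z′ u v ≡ z u v

  updateArc : ArcVars n → Fin n → Fin n → (ℕ → ℕ) → ArcVars n
  updateArc z a b f = updateAt z a (λ row → updateAt row b f)

  module _ (z : ArcVars n) (a b : Fin n) (f : ℕ → ℕ) where

    updateArc-on : updateArc z a b f a b ≡ f (z a b)
    updateArc-on = trans (cong (λ row → row b) (updateAt-updates a z)) (updateAt-updates b (z a))

    updateArc-off-tail : ∀ {u v} → u ≢ a → updateArc z a b f u v ≡ z u v
    updateArc-off-tail {u} {v} u≢a = cong (λ row → row v) (updateAt-minimal u a z u≢a)

    updateArc-off-head : ∀ {u v} → v ≢ b → updateArc z a b f u v ≡ z u v
    updateArc-off-head {u} {v} v≢b with u ≟ a
    ... | yes refl = trans (cong (λ row → row v) (updateAt-updates u z)) (updateAt-minimal v b (z u) v≢b)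
    ... | no  u≢a  = updateArc-off-tail u≢a

  oneMoreOn-increment : ∀ z a b → OneMoreOn a b z (updateArc z a b suc)
  oneMoreOn-increment z a b = record
    { on-arc   = updateArc-on z a b suc
    ; off-tail = updateArc-off-tail z a b suc
    ; off-head = updateArc-off-head z a b suc
    }

  oneMoreOn-decrement : ∀ z a b → 0 < z a b → OneMoreOn a b (updateArc z a b pred) z
  oneMoreOn-decrement z a b zab>0 = record
    { on-arc   = trans (sym (suc-pred (z a b) {{>-nonZero zab>0}})) (cong suc (sym (updateArc-on z a b pred)))
    ; off-tail = sym ∘ updateArc-off-tail z a b pred
    ; off-head = sym ∘ updateArc-off-head z a b pred
    }

  totalFlow : ArcVars n → ℕ
  totalFlow z = sumFin (outflow G z)

  module _ {a b : Fin n} {z z′ : ArcVars n} (ab : Adj G a b) (one-more : OneMoreOn a b z z′) where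
    open OneMoreOn one-more

    on-arc-masked : (if adj G a b then z a b else 0) + 1 ≡ (if adj G a b then z′ a b else 0)
    on-arc-masked rewrite ab = trans (+-comm (z a b) 1) (sym on-arc)

    outflow-tail : outflow G z a + 1 ≡ outflow G z′ a
    outflow-tail = sumFin-differ b (λ v v≢b → cong (if adj G a v then_else 0) (sym (off-head v≢b))) on-arc-masked

    outflow-other : ∀ {w} → w ≢ a → outflow G z′ w ≡ outflow G z w
    outflow-other {w} w≢a = sumFin-cong (λ v → cong (if adj G w v then_else 0) (off-tail w≢a))

    inflow-head : inflow G z b + 1 ≡ inflow G z′ b
    inflow-head = sumFin-differ a (λ u u≢a → cong (if adj G u b then_else 0) (sym (off-tail u≢a))) on-arc-masked

    inflow-other : ∀ {w} → w ≢ b → inflow G z′ w ≡ inflow G z w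
    inflow-other {w} w≢b = sumFin-cong (λ u → cong (if adj G u w then_else 0) (off-head w≢b))

    totalFlow-suc : totalFlow z + 1 ≡ totalFlow z′
    totalFlow-suc = sumFin-differ a (λ w w≢a → sym (outflow-other w≢a)) outflow-tail

    off-arcs : ∀ {u v} → adj G u v ≡ false → z′ u v ≡ z u v
    off-arcs {u} {v} ¬uv with u ≟ a | v ≟ b
    ... | no  u≢a  | _        = off-tail u≢a
    ... | yes refl | no  v≢b  = off-head v≢b
    ... | yes refl | yes refl = contradiction (trans (sym ab) ¬uv) λ ()

    onArcs⇔ : OnArcs G z ⇔ OnArcs G z′
    onArcs⇔ = mk⇔ (λ oa u v ¬uv → trans (off-arcs ¬uv) (oa u v ¬uv))
                  (λ oa u v ¬uv → trans (sym (off-arcs ¬uv)) (oa u v ¬uv))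

    pebbles+inflow : ∀ (p : Config n) {w} → w ≢ a → moveConfig p a b w + inflow G z w ≡ p w + inflow G z′ w
    pebbles+inflow p {w} w≢a = by-cases (w ≟ b)
      where
      by-cases : Dec (w ≡ b) → moveConfig p a b w + inflow G z w ≡ p w + inflow G z′ w
      by-cases (yes refl) = begin
        moveConfig p a w w + inflow G z w  ≡⟨ cong (_+ inflow G z w) (moveConfig-target p w≢a) ⟩
        p w + 1 + inflow G z w             ≡⟨ +-assoc (p w) 1 _ ⟩
        p w + (1 + inflow G z w)           ≡⟨ cong (p w +_) (trans (+-comm 1 _) inflow-head) ⟩
        p w + inflow G z′ w                ∎
        where open ≡-Reasoning
      by-cases (no w≢b) = cong₂ _+_ (moveConfig-other p w≢a w≢b) (sym (inflow-other w≢b))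

    balanced-move : ∀ {p} → 2 ≤ p a → ∀ w →
      (2 * outflow G z w ≤ moveConfig p a b w + inflow G z w) ⇔ (2 * outflow G z′ w ≤ p w + inflow G z′ w)
    balanced-move {p} 2≤pa w = by-cases (w ≟ a)
      where
      by-cases : Dec (w ≡ a) →
        (2 * outflow G z w ≤ moveConfig p a b w + inflow G z w) ⇔ (2 * outflow G z′ w ≤ p w + inflow G z′ w)
      by-cases (yes refl)
        rewrite moveConfig-source p w b | sym outflow-tail | inflow-other (adj⇒≢ G ab ∘ sym)
        = 2*o≤P∸2+I⇔2*[o+1]≤P+I {outflow G z w} 2≤pa
      by-cases (no w≢a) rewrite outflow-other w≢a | pebbles+inflow p w≢a = mk⇔ id id

    feasible-move : ∀ {r p} → 2 ≤ p a → a ≢ r → SOLFeasible G r (moveConfig p a b) z ⇔ SOLFeasible G r p z′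
    feasible-move 2≤pa a≢r = mk⇔
      (λ (oa , bal , out-r) → to onArcs⇔ oa , (λ w → to (balanced-move 2≤pa w) (bal w)) ,
                              subst (_≤ 0) (sym (outflow-other (a≢r ∘ sym))) out-r)
      (λ (oa , bal , out-r) → from onArcs⇔ oa , (λ w → from (balanced-move 2≤pa w) (bal w)) ,
                              subst (_≤ 0) (outflow-other (a≢r ∘ sym)) out-r)
      where open Equivalence

  zeroFlow : ArcVars n
  zeroFlow _ _ = 0

  outflow-zeroFlow : ∀ v → outflow G zeroFlow v ≡ 0
  outflow-zeroFlow v = trans (sumFin-cong (λ u → Bool.if-eta (adj G v u))) (sumFin-zero n)

  inflow-zeroFlow : ∀ v → inflow G zeroFlow v ≡ 0
  inflow-zeroFlow v = trans (sumFin-cong (λ u → Bool.if-eta (adj G u v))) (sumFin-zero n)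

  positive-arc : ∀ {z v} → 0 < outflow G z v → ∃[ b ] (Adj G v b × 0 < z v b)
  positive-arc {z} {v} out>0 with sumFin-pos (λ b → if adj G v b then z v b else 0) out>0
  ... | b , arc>0 with adj G v b in vb
  ...   | true  = b , vb , arc>0
  ...   | false = contradiction arc>0 λ ()

  module _ (r : Fin n) where

    zeroFlow-feasible : ∀ p → SOLFeasible G r p zeroFlow
    zeroFlow-feasible p =
      (λ _ _ _ → refl) ,
      (λ w → subst (λ o → 2 * o ≤ p w + inflow G zeroFlow w) (sym (outflow-zeroFlow w)) z≤n) ,
      ≤-reflexive (outflow-zeroFlow r)

    FlowSolvable : Config n → Set
    FlowSolvable p = ∃[ z ] (SOLFeasible G r p z × 1 ≤ p r + inflow G z r)

    moves⇒flowSolvable : ∀ {p q} → Star (Move G) p q → 1 ≤ q r → FlowSolvable p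
    moves⇒flowSolvable ε q-r>0 = zeroFlow , zeroFlow-feasible _ , ≤-trans q-r>0 (m≤m+n _ _)
    moves⇒flowSolvable {p} ((a , b , ab , 2≤pa , refl) ◅ rest) q-r>0 with a ≟ r
    ... | yes refl = zeroFlow , zeroFlow-feasible p , ≤-trans (≤-trans (s≤s z≤n) 2≤pa) (m≤m+n _ _)
    ... | no  a≢r with moves⇒flowSolvable rest q-r>0
    ...   | z , feasible , pos =
      updateArc z a b suc ,
      Equivalence.to (feasible-move ab one-more 2≤pa a≢r) feasible ,
      subst (1 ≤_) (pebbles+inflow ab one-more p (a≢r ∘ sym)) pos
      where
      one-more : OneMoreOn a b z (updateArc z a b suc)
      one-more = oneMoreOn-increment z a b

    solvable⇒flowSolvable : ∀ {p} → Solvable G r p → FlowSolvable p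
    solvable⇒flowSolvable (_ , p→q , q-r>0) = moves⇒flowSolvable p→q q-r>0

    -- Otherwise every vertex sends out at most what it receives, and r strictly less,
    -- contradicting that the total outflow equals the total inflow.
    flow-source : ∀ {p z} → SOLFeasible G r p z → 1 ≤ inflow G z r → ∃[ v ] (2 ≤ p v × 0 < outflow G z v)
    flow-source {p} {z} (_ , balanced , out-r≤0) in-r>0 with any? (λ v → 2 ≤? p v ×-dec 0 <? outflow G z v)
    ... | yes source = source
    ... | no  none   = contradiction (sumFin-comm (λ u v → if adj G u v then z u v else 0))
                                     (<⇒≢ (sumFin-mono-< out≤in r out<in))
      where
      out≤in : ∀ v → outflow G z v ≤ inflow G z v
      out≤in v = 2*o≤P+I⇒o≤I (balanced v) (λ out>0 → ≰⇒> (λ 2≤pv → none (v , 2≤pv , out>0)))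
      out<in : outflow G z r < inflow G z r
      out<in = subst (_< inflow G z r) (sym (n≤0⇒n≡0 out-r≤0)) in-r>0

    unwind : ∀ k {p} z → totalFlow z < k → SOLFeasible G r p z → 1 ≤ p r + inflow G z r → Solvable G r p
    unwind (suc k) {p} z T<1+k feasible pos with 1 ≤? p r
    ... | yes p-r>0 = p , ε , p-r>0
    ... | no  p-r≯0 with flow-source feasible (subst (λ pr → 1 ≤ pr + inflow G z r) (n≤0⇒n≡0 (≮⇒≥ p-r≯0)) pos)
    ...   | v , 2≤pv , out>0 with positive-arc {z} out>0
    ...     | b , vb , zvb>0 = solvable-◅ G r (v , b , vb , 2≤pv , refl) (unwind k z⁻ T⁻<k feasible⁻ pos⁻)
      where
      z⁻ : ArcVars n
      z⁻ = updateArc z v b pred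
      one-more : OneMoreOn v b z⁻ z
      one-more = oneMoreOn-decrement z v b zvb>0
      v≢r : v ≢ r
      v≢r v≡r = <⇒≢ out>0 (sym (n≤0⇒n≡0 out-v≤0))
        where
        out-v≤0 : outflow G z v ≤ 0
        out-v≤0 = subst (λ x → outflow G z x ≤ 0) (sym v≡r) (proj₂ (proj₂ feasible))
      feasible⁻ : SOLFeasible G r (moveConfig p v b) z⁻
      feasible⁻ = Equivalence.from (feasible-move vb one-more 2≤pv v≢r) feasible
      pos⁻ : 1 ≤ moveConfig p v b r + inflow G z⁻ r
      pos⁻ = subst (1 ≤_) (sym (pebbles+inflow vb one-more p (v≢r ∘ sym))) pos
      T⁻<k : totalFlow z⁻ < k
      T⁻<k = <-≤-trans (≤-reflexive (trans (+-comm 1 _) (totalFlow-suc vb one-more))) (s≤s⁻¹ T<1+k)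

    flowSolvable⇒solvable : ∀ {p} → FlowSolvable p → Solvable G r p
    flowSolvable⇒solvable (z , feasible , pos) = unwind (suc (totalFlow z)) z ≤-refl feasible pos

    solvable-mono : ∀ {p p′} → (∀ v → p v ≤ p′ v) → Solvable G r p → Solvable G r p′
    solvable-mono p≤p′ = flowSolvable⇒solvable ∘ more-pebbles ∘ solvable⇒flowSolvable
      where
      more-pebbles : FlowSolvable _ → FlowSolvable _
      more-pebbles (z , (oa , balanced , out-r≤0) , pos) =
        z , (oa , (λ w → ≤-trans (balanced w) (+-monoˡ-≤ _ (p≤p′ w))) , out-r≤0) , ≤-trans pos (+-monoˡ-≤ _ (p≤p′ r))

module _ {n} (G : Graph n) (S : Subset n) (r : Fin n) where

  allSolvable-mono : ∀ {m k} → AllSolvable G S r m → m ≤ k → AllSolvable G S r k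
  allSolvable-mono {m} all m≤k p |p|≡k p⊆S with m≤n⇒∃[o]m+o≡n (subst (m ≤_) (sym |p|≡k) m≤k)
  ... | d , m+d≡|p| with subconfiguration m d p (sym m+d≡|p|)
  ... | p′ , |p′|≡m , p′≤p =
    solvable-mono G r p′≤p (all p′ |p′|≡m (λ v p′v>0 → p⊆S v (<-≤-trans p′v>0 (p′≤p v))))

  Counterexample : ℕ → Config n → Set
  Counterexample k p = size p ≡ k × SupportIn p S × ¬ Solvable G r p

  counterexample? : ∀ k p → Dec (Counterexample k p)
  counterexample? k p = size p ℕ.≟ k ×-dec all? (λ v → 0 <? p v →-dec v ∈? S) ×-dec ¬? (solvable? G r p)

  allSolvable-or-counterexample : ∀ k → AllSolvable G S r k ⊎ ∃[ p ] Counterexample k p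
  allSolvable-or-counterexample k with any? (λ i → counterexample? k (decode k i))
  ... | yes (i , counterexample) = inj₂ (decode k i , counterexample)
  ... | no  none                 = inj₁ all-solvable
    where
    all-solvable : AllSolvable G S r k
    all-solvable p |p|≡k p⊆S with decode-surjective p (λ v → subst (p v ≤_) |p|≡k (≤-sumFin p v))
    ... | i , decoded≗p = decidable-stable (solvable? G r p) λ unsolvable →
      none (i , trans (sumFin-cong decoded≗p) |p|≡k ,
                (λ v decoded-v>0 → p⊆S v (subst (0 <_) (decoded≗p v) decoded-v>0)) ,
                unsolvable ∘ solvable-mono G r (≤-reflexive ∘ decoded≗p))

  allSolvable? : ∀ k → Dec (AllSolvable G S r k)
  allSolvable? k with allSolvable-or-counterexample k
  ... | inj₁ all-solvable                  = yes all-solvable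
  ... | inj₂ (p , |p|≡k , p⊆S , unsolvable) = no λ all-solvable → unsolvable (all-solvable p |p|≡k p⊆S)

  pebblingNumber : ∃[ m ] IsPebblingNumber G S r m
  pebblingNumber = least-upward-closed (AllSolvable G S r) allSolvable-mono allSolvable? (allSolvable-bound G r S)

  ¬allSolvable-0 : ¬ AllSolvable G S r 0
  ¬allSolvable-0 all-solvable = zero-unsolvable G r (all-solvable (λ _ → 0) (sumFin-zero n) (λ _ ()))

  critical-counterexample : ∀ {m} → IsPebblingNumber G S r (suc m) → ∃[ p ] Counterexample m p
  critical-counterexample {m} (_ , least) with allSolvable-or-counterexample m
  ... | inj₁ all-solvable  = contradiction (least m all-solvable) 1+n≰n
  ... | inj₂ counterexample = counterexample

  supportIn⇔upperVars : ∀ {p} → SupportIn p S ⇔ UpperVars S p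
  supportIn⇔upperVars = mk⇔
    (λ p⊆S v v∉S → n≤0⇒n≡0 (≮⇒≥ (v∉S ∘ p⊆S v)))
    (λ upper v pv>0 → decidable-stable (v ∈? S) (λ v∉S → <⇒≢ pv>0 (sym (upper v v∉S))))

  unsolvable⇒PIFeasible : ∀ {p} → SupportIn p S → n ≤ size p → ¬ Solvable G r p → PIFeasible G S r (zeroFlow G) p
  unsolvable⇒PIFeasible {p} p⊆S n≤|p| unsolvable =
    Equivalence.to supportIn⇔upperVars p⊆S , n≤|p| , (zeroFlow-feasible G r p , optimal) ,
    ≤-reflexive (inflow-zeroFlow G r)
    where
    optimal : ∀ z → SOLFeasible G r p z → SOLObj G r z ≤ SOLObj G r (zeroFlow G)
    optimal z feasible = subst (inflow G z r ≤_) (sym (inflow-zeroFlow G r)) (≮⇒≥ λ in-r>0 →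
      unsolvable (flowSolvable⇒solvable G r (z , feasible , ≤-trans in-r>0 (m≤n+m _ _))))

  PIFeasible⇒unsolvable : r ∉ S → ∀ {x y} → PIFeasible G S r x y → SupportIn y S × ¬ Solvable G r y
  PIFeasible⇒unsolvable r∉S {y = y} (upper , _ , (_ , optimal) , obj≤0) =
    Equivalence.from supportIn⇔upperVars upper , unsolvable
    where
    unsolvable : ¬ Solvable G r y
    unsolvable solvable with solvable⇒flowSolvable G r solvable
    ... | z , feasible , pos = contradiction (≤-trans in-r>0 (≤-trans (optimal z feasible) obj≤0)) λ ()
      where
      in-r>0 : 1 ≤ inflow G z r
      in-r>0 = subst (λ yr → 1 ≤ yr + inflow G z r) (upper r r∉S) pos

  PIFeasible⇒size< : r ∉ S → ∀ {m x y} → IsPebblingNumber G S r m → PIFeasible G S r x y → size y < m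
  PIFeasible⇒size< r∉S (all-solvable , _) feasible with PIFeasible⇒unsolvable r∉S feasible
  ... | y⊆S , unsolvable = ≰⇒> λ m≤|y| → unsolvable (allSolvable-mono all-solvable m≤|y| _ refl y⊆S)

theorem3 : ∀ {n} (G : Graph n) (r : Fin n) (S : Subset n) → r ∉ S →
    ∃[ m ] (IsPebblingNumber G S r m
      × (¬ PIIsFeasible G S r → m ≤ n)
      × (PIIsFeasible G S r → PIOptimalValue G S r (m ∸ 1)))
theorem3 {n} G r S r∉S with pebblingNumber G S r
... | zero  , (all-solvable , _) = contradiction all-solvable (¬allSolvable-0 G S r)
... | suc m , π with critical-counterexample G S r π
...   | p , |p|≡m , p⊆S , unsolvable = suc m , π , π≤n , optimal
  where
  witness : n ≤ m → PIFeasible G S r (zeroFlow G) p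
  witness n≤m = unsolvable⇒PIFeasible G S r p⊆S (subst (n ≤_) (sym |p|≡m) n≤m) unsolvable
  bounded : ∀ x y → PIFeasible G S r x y → size y ≤ m
  bounded x y feasible = s≤s⁻¹ (PIFeasible⇒size< G S r r∉S π feasible)
  π≤n : ¬ PIIsFeasible G S r → suc m ≤ n
  π≤n infeasible = ≮⇒≥ λ n<1+m → infeasible (zeroFlow G , p , witness (s≤s⁻¹ n<1+m))
  optimal : PIIsFeasible G S r → PIOptimalValue G S r m
  optimal (x , y , feasible@(_ , n≤|y| , _)) =
    (zeroFlow G , p , witness (≤-trans n≤|y| (bounded x y feasible)) , |p|≡m) , bounded
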